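{- Let $p,t$ be positive integers, let $n_1,\dots,n_p$ be positive integers, let $X=[n]$ with $n=n_1+\cdots+n_p$, partitioned into consecutive blocks $X_1=[n_1]$ and $X_i=\left[\sum_{j\le i}n_j\right]\setminus\left[\sum_{j\le i-1}n_j\right]$ for $i=2,\dots,p$. Let $\mathcal{R}\subset(\mathbb{Z}^+)^p$ be a non-empty finite set, let $$\mathcal{H}_2=\bigcup_{(r_1,\dots,r_p)\in\mathcal{R}}\left\{F\subset X:|F\cap X_i|=r_i,\ i=1,\dots,p\right\},$$ and for each $m\in[p]$ let $b_m=\max_{(r_1,\dots,r_p)\in\mathcal{R}}r_m$. Let $\mathcal{F}\subset\mathcal{H}_2$ be a $t$-intersecting family and suppose $n_m>2(t+1)b_m$ for every $m\in[p]$. If for some $l\in[p]$ and some $i,j\in X_l$ the family $\Delta_{i,j}(\mathcal{F})$ is a full $t$-star in $\mathcal{H}_2$, then $\mathcal{F}$ is also a full $t$-star in $\mathcal{H}_2$.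
   Context: A family is $t$-intersecting if any two of its members share at least $t$ elements. For $i,j\in X$ and $F\subset X$, $\delta_{i,j}(F)=(F\setminus\{j\})\cup\{i\}$ if $j\in F$, $i\notin F$, and $\delta_{i,j}(F)=F$ otherwise; $\Delta_{i,j}(\mathcal{F})=\{\delta_{i,j}(F):F\in\mathcal{F}\}\cup\{F\in\mathcal{F}:\delta_{i,j}(F)\in\mathcal{F}\}$. A subfamily $\mathcal{F}\subset\mathcal{H}$ is a full $t$-star in $\mathcal{H}$ if there is a $t$-subset $T\subset X$ with $\mathcal{F}=\{F\in\mathcal{H}:T\subset F\}$. -}

module Defs where

open import Data.Nat using (ℕ; zero; suc; _+_; _≤_; _<_; _⊔_)
open import Data.Nat.Properties using (_≤?_; _<?_)
open import Data.Bool using (Bool; true; false; if_then_else_; _∧_; not)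
open import Data.Fin using (Fin; toℕ) renaming (zero to fzero; suc to fsuc)
open import Data.Fin.Subset using (Subset; _∩_; ∣_∣; _⊆_; inside; outside)
open import Data.Vec using (lookup; tabulate; _[_]≔_)
open import Data.List using (List)
import Data.List as L
open import Data.Product using (Σ; _×_; ∃)
open import Data.Sum using (_⊎_)
open import Function using (_∘_)
open import Function.Bundles using (_⇔_)
open import Relation.Nullary.Decidable using (does)
open import Data.List.Relation.Unary.Any using (Any)
open import Relation.Binary.PropositionalEquality using (_≡_)

psum : ∀ {p} → (Fin p → ℕ) → ℕ → ℕ
psum {zero}  ns _       = 0
psum {suc p} ns zero    = 0
psum {suc p} ns (suc k) = ns fzero + psum (ns ∘ fsuc) k

total : ∀ {p} → (Fin p → ℕ) → ℕ
total {p} ns = psum ns p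

-- X = [n] is modelled as Fin n (element x ∈ Fin n stands for x+1 ∈ [n]).
-- Block X_l (l : Fin p, 0-based) = { x : psum ns l ≤ x < psum ns (l+1) }.
inBlock : ∀ {p} (ns : Fin p → ℕ) → Fin p → Fin (total ns) → Bool
inBlock ns l x = does (psum ns (toℕ l) ≤? toℕ x) ∧ does (toℕ x <? psum ns (suc (toℕ l)))

block : ∀ {p} (ns : Fin p → ℕ) → Fin p → Subset (total ns)
block ns l = tabulate (inBlock ns l)

Family : ℕ → Set₁
Family n = Subset n → Set

H₂ : ∀ {p} (ns : Fin p → ℕ) → List (Fin p → ℕ) → Family (total ns)
H₂ ns R F = Any (λ r → ∀ i → ∣ F ∩ block ns i ∣ ≡ r i) R

bmax : ∀ {p} → List (Fin p → ℕ) → Fin p → ℕ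
bmax R m = L.foldr (λ r acc → r m ⊔ acc) 0 R

_⊑_ : ∀ {n} → Family n → Family n → Set
𝓕 ⊑ 𝓖 = ∀ F → 𝓕 F → 𝓖 F

Intersecting : ∀ {n} → ℕ → Family n → Set
Intersecting t 𝓕 = ∀ A B → 𝓕 A → 𝓕 B → t ≤ ∣ A ∩ B ∣

δ : ∀ {n} → Fin n → Fin n → Subset n → Subset n
δ i j F = if lookup F j ∧ not (lookup F i) then (F [ j ]≔ outside) [ i ]≔ inside else F

Δ : ∀ {n} → Fin n → Fin n → Family n → Family n
Δ i j 𝓕 G = (Σ (Subset _) λ F → 𝓕 F × δ i j F ≡ G) ⊎ (𝓕 G × 𝓕 (δ i j G))

FullStar : ∀ {n} → ℕ → Family n → Family n → Set
FullStar {n} t 𝓗 𝓕 = Σ (Subset n) λ T → (∣ T ∣ ≡ t) × (∀ F → 𝓕 F ⇔ (𝓗 F × T ⊆ F))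

-- Let T be the centre of the star Δ i j 𝓕, and call F shiftable when j ∈ F and i ∉ F.
-- If no member of 𝓕 is shiftable then Δ i j 𝓕 = 𝓕; this is the case when j ∈ T.
-- If i ∉ T, shifting does not affect whether T ⊆ F, and 𝓕 is again the star of T.
-- Otherwise i ∈ T and j ∉ T. Given P ∈ 𝓕 with T ⊆ P, j ∉ P and Q ∈ 𝓕 with i ∉ Q, the
-- bound on n_m leaves room in every block to complete T, outside P ∪ Q, to a set C with the
-- block sizes of P. Then C ∈ Δ i j 𝓕, so C or its unshifted preimage is in 𝓕 and meets
-- Q or P inside T - i, in fewer than t points. Hence either no member of 𝓕 is shiftable,
-- or every member of 𝓕 containing T contains j, and then 𝓕 is the star of T - i + j.

module Submission where

open import Defs
open import Data.Nat using (ℕ; zero; suc; _+_; _∸_; _*_; _≤_; _<_; z≤n; s≤s)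
import Data.Nat as ℕ
open import Data.Nat.Properties
  using (_≤?_; _<?_; ≤-refl; ≤-reflexive; ≤-trans; <-≤-trans; ≤-<-trans; <-irrefl; <-cmp; <⇒≤; <⇒≱; n≤1+n;
         +-identityʳ; +-assoc; +-mono-≤; +-monoˡ-≤; +-monoʳ-≤; +-cancelˡ-≤; *-monoˡ-≤; *-monoʳ-≤;
         m∸n≤m; m≤n+o⇒m∸n≤o; m+[n∸m]≡n; n≤0⇒n≡0; m≤m⊔n; m≤n⊔m; module ≤-Reasoning; +-0-commutativeMonoid)
open import Data.Bool using (Bool; true; false; _∧_; _∨_; not)
open import Data.Bool.Properties using (∧-distribʳ-∨; ∧-conicalˡ; ∧-conicalʳ; ∨-conicalˡ; ∨-conicalʳ; not-injective)
open import Data.Empty using (⊥; ⊥-elim)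
open import Data.Fin using (Fin; toℕ; _≟_) renaming (zero to fzero; suc to fsuc)
open import Data.Fin.Properties using (toℕ-injective; toℕ<n; any?; all?)
import Data.Fin.Permutation as Perm
open import Data.Fin.Permutation using (Permutation′; _⟨$⟩ʳ_)
import Data.Fin.Permutation.Components as PC
open import Data.Fin.Subset using (Subset; _∩_; ∣_∣; _∈_; _∉_; _⊆_; _-_; inside; outside)
open import Data.Fin.Subset.Properties
  using (_∈?_; _⊆?_; anySubset?; x∈p∩q⁻; p⊆q⇒∣p∣≤∣q∣; x∈p∧x≢y⇒x∈p-y; x∈p⇒∣p-x∣<∣p∣)
open import Data.Vec using ([]; _∷_; lookup; tabulate; _[_]≔_)
open import Data.Vec.Properties
  using (lookup-zipWith; lookup∘tabulate; lookup∘update; lookup∘update′; tabulate∘lookup; tabulate-cong;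
         []=⇒lookup; lookup⇒[]=)
import Data.Vec.Functional as V
open import Data.List using (List; [])
open import Data.List.Relation.Unary.All using (All)
open import Data.List.Relation.Unary.Any using (Any; here; there)
import Data.List.Relation.Unary.Any as Any
open import Data.Product using (Σ-syntax; _×_; _,_; proj₁; proj₂)
open import Data.Sum using (_⊎_; inj₁; inj₂; [_,_])
open import Algebra.Properties.CommutativeMonoid.Sum +-0-commutativeMonoid
  using (sum; sum-cong-≗; ∑-distrib-+; sum-permute; sum-replicate-zero)
open import Function using (_∘_; case_of_)
open import Function.Bundles using (_⇔_; mk⇔; Equivalence)
import Function.Properties.Equivalence as ⇔
open import Relation.Nullary using (Dec; yes; no; ¬_; ¬?)
open import Relation.Nullary.Decidable using (does; dec-true; dec-false; _×-dec_; decidable-stable)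
open import Relation.Binary.Definitions using (tri<; tri≈; tri>)
open import Relation.Binary.PropositionalEquality hiding ([_])

private
  variable
    n p : ℕ
    i j x : Fin n
    F G T : Subset n
    𝓕 𝓗 : Family n

-- Counting

𝟙 : Bool → ℕ
𝟙 true  = 1
𝟙 false = 0

count : ∀ {n} → (Fin n → Bool) → ℕ
count f = sum (𝟙 ∘ f)

∑-mono-≤ : {u v : Fin n → ℕ} → (∀ x → u x ≤ v x) → sum u ≤ sum v
∑-mono-≤ {zero}  _   = z≤n
∑-mono-≤ {suc n} u≤v = +-mono-≤ (u≤v fzero) (∑-mono-≤ (u≤v ∘ fsuc))

count-false : ∀ n → count {n} (λ _ → false) ≡ 0
count-false n = sum-replicate-zero n

count-cong : {f g : Fin n → Bool} → (∀ x → f x ≡ g x) → count f ≡ count g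
count-cong f≗g = sum-cong-≗ (cong 𝟙 ∘ f≗g)

count-mono : {f g : Fin n → Bool} → (∀ x → f x ≡ true → g x ≡ true) → count f ≤ count g
count-mono {f = f} {g = g} f⇒g = ∑-mono-≤ λ x → 𝟙-mono (f⇒g x)
  where
  𝟙-mono : ∀ {a b} → (a ≡ true → b ≡ true) → 𝟙 a ≤ 𝟙 b
  𝟙-mono {false} _   = z≤n
  𝟙-mono {true}  a⇒b rewrite a⇒b refl = ≤-refl

count-∨-≤ : {f g : Fin n → Bool} → count (λ x → f x ∨ g x) ≤ count f + count g
count-∨-≤ {f = f} {g = g} = begin
  count (λ x → f x ∨ g x)         ≤⟨ ∑-mono-≤ (λ x → 𝟙-∨ (f x) (g x)) ⟩
  sum (λ x → 𝟙 (f x) + 𝟙 (g x))  ≡⟨ ∑-distrib-+ (𝟙 ∘ f) (𝟙 ∘ g) ⟩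
  count f + count g               ∎
  where
  open ≤-Reasoning
  𝟙-∨ : ∀ a b → 𝟙 (a ∨ b) ≤ 𝟙 a + 𝟙 b
  𝟙-∨ true  _ = s≤s z≤n
  𝟙-∨ false _ = ≤-refl

count-∨-disjoint : {f g : Fin n → Bool} → (∀ x → f x ∧ g x ≡ false) → count (λ x → f x ∨ g x) ≡ count f + count g
count-∨-disjoint {f = f} {g = g} disj =
  trans (sum-cong-≗ λ x → 𝟙-∨ (f x) (g x) (disj x)) (∑-distrib-+ (𝟙 ∘ f) (𝟙 ∘ g))
  where
  𝟙-∨ : ∀ a b → a ∧ b ≡ false → 𝟙 (a ∨ b) ≡ 𝟙 a + 𝟙 b
  𝟙-∨ true  false _ = refl
  𝟙-∨ false _     _ = refl

count-∧-not : {f g : Fin n → Bool} → count (λ x → f x ∧ g x) + count (λ x → not (f x) ∧ g x) ≡ count g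
count-∧-not {f = f} {g = g} =
  trans (sym (∑-distrib-+ (λ x → 𝟙 (f x ∧ g x)) (λ x → 𝟙 (not (f x) ∧ g x))))
        (sum-cong-≗ λ x → 𝟙-split (f x) (g x))
  where
  𝟙-split : ∀ a b → 𝟙 (a ∧ b) + 𝟙 (not a ∧ b) ≡ 𝟙 b
  𝟙-split true  b = +-identityʳ (𝟙 b)
  𝟙-split false b = refl

count-permute : {f : Fin n → Bool} → (π : Permutation′ n) → count (f ∘ (π ⟨$⟩ʳ_)) ≡ count f
count-permute {f = f} π = sym (sum-permute (𝟙 ∘ f) π)

∣p∣≡count : (s : Subset n) → ∣ s ∣ ≡ count (lookup s)
∣p∣≡count []          = refl
∣p∣≡count (true ∷ s)  = cong suc (∣p∣≡count s)
∣p∣≡count (false ∷ s) = ∣p∣≡count s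

∣p∩q∣≡count : (s s′ : Subset n) → ∣ s ∩ s′ ∣ ≡ count (λ x → lookup s x ∧ lookup s′ x)
∣p∩q∣≡count s s′ = trans (∣p∣≡count (s ∩ s′)) (count-cong λ x → lookup-zipWith _∧_ x s s′)

Disjoint : (Fin p → Fin n → Bool) → Set
Disjoint B = ∀ {m m′} x → B m x ≡ true → B m′ x ≡ true → m ≡ m′

choose-profile : (U : Fin n → Bool) (B : Fin p → Fin n → Bool) → Disjoint B
  → (k : Fin p → ℕ) → (∀ m → k m ≤ count (λ x → U x ∧ B m x))
  → Σ[ D ∈ (Fin n → Bool) ] (∀ x → D x ≡ true → U x ≡ true) × (∀ m → count (λ x → D x ∧ B m x) ≡ k m)
choose-profile {zero} U B _ k k≤ = (λ _ → false) , (λ _ ()) , λ m → sym (n≤0⇒n≡0 (k≤ m))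
choose-profile {suc n} U B disj k k≤
  with any? (λ m → ((U fzero ∧ B m fzero) Data.Bool.≟ true) ×-dec (0 <? k m))
... | yes (m₀ , U₀∧B₀ , k₀>0) =
  let D , D⇒U , count-D = choose-profile (U ∘ fsuc) (λ m → B m ∘ fsuc) (disj ∘ fsuc) k′ k′≤
  in  true V.∷ D
    , (λ { fzero _ → U₀ ; (fsuc x) → D⇒U x })
    , λ m → trans (cong (𝟙 (B m fzero) +_) (count-D m)) (m+[n∸m]≡n (B₀≤k m))
  where
  U₀ : U fzero ≡ true
  U₀ = ∧-conicalˡ (U fzero) (B m₀ fzero) U₀∧B₀
  k′ : Fin _ → ℕ
  k′ m = k m ∸ 𝟙 (B m fzero)
  k′≤ : ∀ m → k′ m ≤ count (λ x → U (fsuc x) ∧ B m (fsuc x))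
  k′≤ m = m≤n+o⇒m∸n≤o (k m) (𝟙 (B m fzero))
    (subst (λ u → k m ≤ 𝟙 (u ∧ B m fzero) + count (λ x → U (fsuc x) ∧ B m (fsuc x))) U₀ (k≤ m))
  B₀≤k : ∀ m → 𝟙 (B m fzero) ≤ k m
  B₀≤k m with B m fzero in B₀
  ... | true  = subst (λ m → 0 < k m) (disj fzero (∧-conicalʳ (U fzero) (B m₀ fzero) U₀∧B₀) B₀) k₀>0
  ... | false = z≤n
... | no nothing-wanted =
  let D , D⇒U , count-D = choose-profile (U ∘ fsuc) (λ m → B m ∘ fsuc) (disj ∘ fsuc) k k≤′
  in  false V.∷ D , (λ { fzero () ; (fsuc x) → D⇒U x }) , count-D
  where
  k≤′ : ∀ m → k m ≤ count (λ x → U (fsuc x) ∧ B m (fsuc x))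
  k≤′ m with U fzero ∧ B m fzero in U₀∧B₀ | k m in kₘ | k≤ m
  ... | false | _     | k≤ₘ = k≤ₘ
  ... | true  | zero  | _   = z≤n
  ... | true  | suc _ | _   = ⊥-elim (nothing-wanted (m , U₀∧B₀ , subst (0 <_) (sym kₘ) (s≤s z≤n)))

-- Shifting

subset-ext : {F G : Subset n} → (∀ x → lookup F x ≡ lookup G x) → F ≡ G
subset-ext {F = F} {G} F≗G = begin
  F                  ≡⟨ tabulate∘lookup F ⟨
  tabulate (lookup F) ≡⟨ tabulate-cong F≗G ⟩
  tabulate (lookup G) ≡⟨ tabulate∘lookup G ⟩
  G                  ∎
  where open ≡-Reasoning

∈⇒lookup : x ∈ F → lookup F x ≡ true
∈⇒lookup = []=⇒lookup

lookup⇒∈ : lookup F x ≡ true → x ∈ F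
lookup⇒∈ {F = F} {x = x} e = lookup⇒[]= x F e

∉⇒lookup : x ∉ F → lookup F x ≡ false
∉⇒lookup {x = x} {F = F} x∉F with lookup F x in e
... | true  = ⊥-elim (x∉F (lookup⇒∈ e))
... | false = refl

false⇒∉ : lookup F x ≡ false → x ∉ F
false⇒∉ F[x] x∈F = case trans (sym F[x]) (∈⇒lookup x∈F) of λ ()

shift : Fin n → Fin n → Subset n → Subset n
shift i j F = (F [ j ]≔ outside) [ i ]≔ inside

Shiftable : Fin n → Fin n → Subset n → Set
Shiftable i j F = j ∈ F × i ∉ F

shiftable⇒≢ : Shiftable i j F → i ≢ j
shiftable⇒≢ (j∈F , i∉F) refl = i∉F j∈F

lookup-shiftˡ : (i j : Fin n) (F : Subset n) → lookup (shift i j F) i ≡ true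
lookup-shiftˡ i j F = lookup∘update i (F [ j ]≔ outside) inside

lookup-shiftʳ : i ≢ j → (F : Subset n) → lookup (shift i j F) j ≡ false
lookup-shiftʳ {i = i} {j} i≢j F =
  trans (lookup∘update′ (i≢j ∘ sym) (F [ j ]≔ outside) inside) (lookup∘update j F outside)

lookup-shift-other : x ≢ i → x ≢ j → (F : Subset n) → lookup (shift i j F) x ≡ lookup F x
lookup-shift-other x≢i x≢j F =
  trans (lookup∘update′ x≢i (F [ _ ]≔ outside) inside) (lookup∘update′ x≢j F outside)

∈-shiftˡ : (F : Subset n) → i ∈ shift i j F
∈-shiftˡ {i = i} {j} F = lookup⇒∈ (lookup-shiftˡ i j F)

∉-shiftʳ : i ≢ j → (F : Subset n) → j ∉ shift i j F
∉-shiftʳ i≢j F j∈ = case trans (sym (∈⇒lookup j∈)) (lookup-shiftʳ i≢j F) of λ ()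

∈-shift⁺ : x ≢ i → x ≢ j → x ∈ F → x ∈ shift i j F
∈-shift⁺ {F = F} x≢i x≢j x∈F = lookup⇒∈ (trans (lookup-shift-other x≢i x≢j F) (∈⇒lookup x∈F))

∈-shift⁻ : x ≢ i → x ≢ j → x ∈ shift i j F → x ∈ F
∈-shift⁻ {F = F} x≢i x≢j x∈ = lookup⇒∈ (trans (sym (lookup-shift-other x≢i x≢j F)) (∈⇒lookup x∈))

lookup-shift : Shiftable i j F → ∀ x → lookup (shift i j F) x ≡ lookup F (PC.transpose i j x)
lookup-shift {i = i} {j} {F} (j∈F , i∉F) x with x ≟ i | x ≟ j
... | yes refl | _        = trans (lookup-shiftˡ i j F) (sym (∈⇒lookup j∈F))
... | no _     | yes refl rewrite dec-true (j ≟ j) refl =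
  trans (lookup-shiftʳ (shiftable⇒≢ (j∈F , i∉F)) F) (sym (∉⇒lookup i∉F))
... | no x≢i   | no x≢j   rewrite dec-false (x ≟ j) x≢j = lookup-shift-other x≢i x≢j F

shift-injective : Shiftable i j F → Shiftable i j G → shift i j F ≡ shift i j G → F ≡ G
shift-injective {i = i} {j} {F} {G} F-sh G-sh eq = subset-ext λ x → begin
  lookup F x                             ≡⟨ cong (lookup F) (PC.transpose-inverse i j) ⟨
  lookup F (PC.transpose i j (PC.transpose j i x)) ≡⟨ lookup-shift F-sh _ ⟨
  lookup (shift i j F) (PC.transpose j i x) ≡⟨ cong (λ H → lookup H (PC.transpose j i x)) eq ⟩
  lookup (shift i j G) (PC.transpose j i x) ≡⟨ lookup-shift G-sh _ ⟩
  lookup G (PC.transpose i j (PC.transpose j i x)) ≡⟨ cong (lookup G) (PC.transpose-inverse i j) ⟩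
  lookup G x                             ∎
  where open ≡-Reasoning

shiftable? : (i j : Fin n) (F : Subset n) → Dec (Shiftable i j F)
shiftable? i j F = j ∈? F ×-dec ¬? (i ∈? F)

δ-shiftable : Shiftable i j F → δ i j F ≡ shift i j F
δ-shiftable (j∈F , i∉F) rewrite ∈⇒lookup j∈F | ∉⇒lookup i∉F = refl

δ-unshiftable : ¬ Shiftable i j F → δ i j F ≡ F
δ-unshiftable {i = i} {j} {F} ¬sh with lookup F j in F[j] | lookup F i in F[i]
... | true  | true  = refl
... | false | _     = refl
... | true  | false = ⊥-elim (¬sh (lookup⇒∈ F[j] , λ i∈F → case trans (sym F[i]) (∈⇒lookup i∈F) of λ ()))

Δ-δ : 𝓕 F → Δ i j 𝓕 (δ i j F)
Δ-δ 𝓕F = inj₁ (_ , 𝓕F , refl)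

Δ-elim : Δ i j 𝓕 G → 𝓕 G ⊎ Σ[ F ∈ Subset _ ] 𝓕 F × Shiftable i j F × G ≡ shift i j F
Δ-elim (inj₂ (𝓕G , _)) = inj₁ 𝓕G
Δ-elim {i = i} {j = j} {𝓕 = 𝓕} (inj₁ (F , 𝓕F , δF≡G)) with shiftable? i j F
... | yes sh  = inj₂ (F , 𝓕F , sh , trans (sym δF≡G) (δ-shiftable sh))
... | no ¬sh = inj₁ (subst 𝓕 (trans (sym (δ-unshiftable ¬sh)) δF≡G) 𝓕F)

Δ-shiftable : Δ i j 𝓕 G → Shiftable i j G → 𝓕 G × 𝓕 (shift i j G)
Δ-shiftable {𝓕 = 𝓕} (inj₂ (𝓕G , 𝓕δG)) sh = 𝓕G , subst 𝓕 (δ-shiftable sh) 𝓕δG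
Δ-shiftable {i = i} {j} (inj₁ (F , _ , δF≡G)) (j∈G , i∉G) with shiftable? i j F
... | yes sh  = ⊥-elim (i∉G (subst (i ∈_) (trans (sym (δ-shiftable sh)) δF≡G) (∈-shiftˡ F)))
... | no ¬sh = ⊥-elim (¬sh (subst (Shiftable i j) (trans (sym δF≡G) (δ-unshiftable ¬sh)) (j∈G , i∉G)))

Δ-unshiftable : (∀ F → 𝓕 F → ¬ Shiftable i j F) → ∀ G → Δ i j 𝓕 G ⇔ 𝓕 G
Δ-unshiftable {𝓕 = 𝓕} {i = i} {j = j} unsh G = mk⇔ to (λ 𝓕G → inj₁ (G , 𝓕G , δ-unshiftable (unsh G 𝓕G)))
  where
  to : Δ i j 𝓕 G → 𝓕 G
  to ΔG with Δ-elim ΔG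
  ... | inj₁ 𝓕G                = 𝓕G
  ... | inj₂ (F , 𝓕F , sh , _) = ⊥-elim (unsh F 𝓕F sh)

-- Stars

StarOn : Family n → Subset n → Family n → Set
StarOn 𝓗 T 𝓕 = ∀ F → 𝓕 F ⇔ (𝓗 F × T ⊆ F)

module _ {i j : Fin n} {𝓗 𝓕 : Family n} {T : Subset n} (Δ-star : StarOn 𝓗 T (Δ i j 𝓕)) where

  private
    star⁺ : Δ i j 𝓕 F → 𝓗 F × T ⊆ F
    star⁺ = Equivalence.to (Δ-star _)

    star⁻ : 𝓗 F → T ⊆ F → Δ i j 𝓕 F
    star⁻ 𝓗F T⊆F = Equivalence.from (Δ-star _) (𝓗F , T⊆F)

  shift-∈-star : 𝓕 F → Shiftable i j F → 𝓗 (shift i j F) × T ⊆ shift i j F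
  shift-∈-star 𝓕F sh = star⁺ (subst (Δ i j 𝓕) (δ-shiftable sh) (Δ-δ 𝓕F))

  unshifted-∈-star : 𝓕 F → ¬ Shiftable i j F → 𝓗 F × T ⊆ F
  unshifted-∈-star 𝓕F ¬sh = star⁺ (subst (Δ i j 𝓕) (δ-unshiftable ¬sh) (Δ-δ 𝓕F))

  star-unshiftable : (∀ F → 𝓕 F → ¬ Shiftable i j F) → StarOn 𝓗 T 𝓕
  star-unshiftable unsh F = ⇔.trans (⇔.sym (Δ-unshiftable unsh F)) (Δ-star F)

  unshiftable-of-j∈T : j ∈ T → ∀ F → 𝓕 F → ¬ Shiftable i j F
  unshiftable-of-j∈T j∈T F 𝓕F sh = ∉-shiftʳ (shiftable⇒≢ sh) F (proj₂ (shift-∈-star 𝓕F sh) j∈T)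

  star-of-i∉T : 𝓕 ⊑ 𝓗 → i ∉ T → StarOn 𝓗 T 𝓕
  star-of-i∉T 𝓕⊑𝓗 i∉T F = mk⇔ to from
    where
    ⊆-unshift : ∀ {G} → j ∈ G → T ⊆ shift i j G → T ⊆ G
    ⊆-unshift {G} j∈G T⊆ {x} x∈T with x ≟ j
    ... | yes refl = j∈G
    ... | no x≢j  = ∈-shift⁻ (λ { refl → i∉T x∈T }) x≢j (T⊆ x∈T)

    to : 𝓕 F → 𝓗 F × T ⊆ F
    to 𝓕F with shiftable? i j F
    ... | yes sh  = 𝓕⊑𝓗 F 𝓕F , ⊆-unshift (proj₁ sh) (proj₂ (shift-∈-star 𝓕F sh))
    ... | no ¬sh = unshifted-∈-star 𝓕F ¬sh

    from : 𝓗 F × T ⊆ F → 𝓕 F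
    from (𝓗F , T⊆F) with Δ-elim (star⁻ 𝓗F T⊆F)
    ... | inj₁ 𝓕F = 𝓕F
    ... | inj₂ (G , 𝓕G , sh , refl) =
      proj₂ (Δ-shiftable (star⁻ (𝓕⊑𝓗 G 𝓕G) (⊆-unshift (proj₁ sh) T⊆F)) sh)

  star-of-shifted-centre : 𝓕 ⊑ 𝓗 → (∀ F → 𝓗 F → Shiftable i j F → 𝓗 (shift i j F))
    → i ∈ T → j ∉ T → (∀ F → 𝓕 F → T ⊆ F → j ∈ F) → StarOn 𝓗 (shift j i T) 𝓕
  star-of-shifted-centre 𝓕⊑𝓗 𝓗-shift i∈T j∉T j∈star F = mk⇔ to from
    where
    i≢j : i ≢ j
    i≢j refl = j∉T i∈T

    ∉T′ : i ∉ shift j i T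
    ∉T′ = ∉-shiftʳ (i≢j ∘ sym) T

    j∈T′ : j ∈ shift j i T
    j∈T′ = ∈-shiftˡ T

    T-i⊆T′ : ∀ {x} → x ∈ T → x ≢ i → x ∈ shift j i T
    T-i⊆T′ x∈T x≢i = ∈-shift⁺ (λ { refl → j∉T x∈T }) x≢i x∈T

    T′⊆ : ∀ {G} → j ∈ G → (∀ {x} → x ∈ T → x ≢ i → x ∈ G) → shift j i T ⊆ G
    T′⊆ j∈G T-i⊆G {x} x∈T′ with x ≟ j
    ... | yes refl = j∈G
    ... | no x≢j  = T-i⊆G (∈-shift⁻ x≢j x≢i x∈T′) x≢i
      where
      x≢i : x ≢ i
      x≢i refl = ∉T′ x∈T′

    to : 𝓕 F → 𝓗 F × shift j i T ⊆ F
    to 𝓕F with shiftable? i j F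
    ... | yes sh  = 𝓕⊑𝓗 F 𝓕F , T′⊆ (proj₁ sh) λ {x} x∈T x≢i →
      ∈-shift⁻ x≢i (λ { refl → j∉T x∈T }) (proj₂ (shift-∈-star 𝓕F sh) x∈T)
    ... | no ¬sh = let 𝓗F , T⊆F = unshifted-∈-star 𝓕F ¬sh in
      𝓗F , T′⊆ (j∈star F 𝓕F T⊆F) λ x∈T _ → T⊆F x∈T

    T⊆ : ∀ {G} → i ∈ G → shift j i T ⊆ G → T ⊆ G
    T⊆ i∈G T′⊆G {x} x∈T with x ≟ i
    ... | yes refl = i∈G
    ... | no x≢i  = T′⊆G (T-i⊆T′ x∈T x≢i)

    T⊆shift : ∀ {G} → shift j i T ⊆ G → T ⊆ shift i j G
    T⊆shift {G} T′⊆G {x} x∈T with x ≟ i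
    ... | yes refl = ∈-shiftˡ G
    ... | no x≢i  = ∈-shift⁺ x≢i (λ { refl → j∉T x∈T }) (T′⊆G (T-i⊆T′ x∈T x≢i))

    from : 𝓗 F × shift j i T ⊆ F → 𝓕 F
    from (𝓗F , T′⊆F) with i ∈? F
    ... | yes i∈F with Δ-elim (star⁻ 𝓗F (T⊆ i∈F T′⊆F))
    ...   | inj₁ 𝓕F                 = 𝓕F
    ...   | inj₂ (G , _ , sh , refl) = ⊥-elim (∉-shiftʳ (shiftable⇒≢ sh) G (T′⊆F j∈T′))
    from (𝓗F , T′⊆F) | no i∉F
      with Δ-elim (star⁻ (𝓗-shift F 𝓗F (T′⊆F j∈T′ , i∉F)) (T⊆shift T′⊆F))
    ...   | inj₁ 𝓕shift = ⊥-elim (∉-shiftʳ i≢j F (j∈star _ 𝓕shift (T⊆shift T′⊆F)))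
    ...   | inj₂ (G , 𝓕G , shG , eq) = subst 𝓕 (sym (shift-injective (T′⊆F j∈T′ , i∉F) shG eq)) 𝓕G

transpose-invariant : (b : Fin n → Bool) → b i ≡ b j → ∀ x → b (PC.transpose i j x) ≡ b x
transpose-invariant {i = i} {j = j} b bi≡bj x with x ≟ i | x ≟ j
... | yes refl | _      = sym bi≡bj
... | no _     | yes refl rewrite dec-true (j ≟ j) refl = bi≡bj
... | no _     | no x≢j rewrite dec-false (x ≟ j) x≢j = refl

count-shift-∧ : Shiftable i j F → (b : Fin n → Bool) → b i ≡ b j
  → count (λ x → lookup (shift i j F) x ∧ b x) ≡ count (λ x → lookup F x ∧ b x)
count-shift-∧ {i = i} {j = j} {F = F} sh b bi≡bj = begin
  count (λ x → lookup (shift i j F) x ∧ b x)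
    ≡⟨ count-cong (λ x → cong₂ _∧_ (lookup-shift sh x) (sym (transpose-invariant b bi≡bj x))) ⟩
  count ((λ x → lookup F x ∧ b x) ∘ PC.transpose i j)
    ≡⟨ count-permute (Perm.transpose i j) ⟩
  count (λ x → lookup F x ∧ b x) ∎
  where open ≡-Reasoning

∣shift∣ : Shiftable i j F → ∣ shift i j F ∣ ≡ ∣ F ∣
∣shift∣ {i = i} {j = j} {F = F} sh = begin
  ∣ shift i j F ∣                   ≡⟨ ∣p∣≡count (shift i j F) ⟩
  count (lookup (shift i j F))      ≡⟨ count-cong (lookup-shift sh) ⟩
  count (lookup F ∘ PC.transpose i j) ≡⟨ count-permute (Perm.transpose i j) ⟩
  count (lookup F)                  ≡⟨ ∣p∣≡count F ⟨
  ∣ F ∣                             ∎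
  where open ≡-Reasoning

-- Blocks and profiles

same-block : {B : Fin p → Fin n → Bool} → Disjoint B → ∀ {l} → B l i ≡ true → B l j ≡ true
  → ∀ m → B m i ≡ B m j
same-block {i = i} {j = j} {B = B} disj {l} Bli Blj m with B m i in Bmi | B m j in Bmj
... | true  | true  = refl
... | false | false = refl
... | true  | false = sym (trans (sym Bmj) (subst (λ m → B m j ≡ true) (disj i Bli Bmi) Blj))
... | false | true  = trans (sym Bmi) (subst (λ m → B m i ≡ true) (disj j Blj Bmj) Bli)

psum-zero : (ns : Fin p → ℕ) → psum ns 0 ≡ 0
psum-zero {zero}  _ = refl
psum-zero {suc p} _ = refl

psum-suc : (ns : Fin p → ℕ) (l : Fin p) → psum ns (suc (toℕ l)) ≡ psum ns (toℕ l) + ns l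
psum-suc {suc p} ns fzero    = trans (cong (ns fzero +_) (psum-zero (ns ∘ fsuc))) (+-identityʳ (ns fzero))
psum-suc {suc p} ns (fsuc l) =
  trans (cong (ns fzero +_) (psum-suc (ns ∘ fsuc) l)) (sym (+-assoc (ns fzero) _ _))

psum-mono : (ns : Fin p → ℕ) {k k′ : ℕ} → k ≤ k′ → psum ns k ≤ psum ns k′
psum-mono {zero}  ns _ = z≤n
psum-mono {suc p} ns {zero}  _ = z≤n
psum-mono {suc p} ns {suc k} {suc k′} (s≤s k≤k′) = +-monoʳ-≤ (ns fzero) (psum-mono (ns ∘ fsuc) k≤k′)

does-true : ∀ {A : Set} (a? : Dec A) → does a? ≡ true → A
does-true (yes a) _ = a

inBlock-bounds : (ns : Fin p → ℕ) (l : Fin p) (x : Fin (total ns)) → inBlock ns l x ≡ true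
  → psum ns (toℕ l) ≤ toℕ x × toℕ x < psum ns (suc (toℕ l))
inBlock-bounds ns l x x∈l =
    does-true (_ ≤? _) (∧-conicalˡ _ _ x∈l)
  , does-true (_ <? _) (∧-conicalʳ _ _ x∈l)

inBlock-disjoint : (ns : Fin p → ℕ) → Disjoint (inBlock ns)
inBlock-disjoint ns {l} {m} x x∈l x∈m
  with inBlock-bounds ns l x x∈l | inBlock-bounds ns m x x∈m | <-cmp (toℕ l) (toℕ m)
... | _ | _ | tri≈ _ l≡m _ = toℕ-injective l≡m
... | _ , x<l₊ | m≤x , _ | tri< l<m _ _ =
  ⊥-elim (<-irrefl refl (<-≤-trans x<l₊ (≤-trans (psum-mono ns l<m) m≤x)))
... | l≤x , _ | _ , x<m₊ | tri> _ _ m<l =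
  ⊥-elim (<-irrefl refl (<-≤-trans x<m₊ (≤-trans (psum-mono ns m<l) l≤x)))

count-below : ∀ n d → d ≤ n → count {n} (λ x → does (toℕ x <? d)) ≡ d
count-below n       zero    _         = count-false n
count-below (suc n) (suc d) (s≤s d≤n) = cong suc (count-below n d d≤n)

count-interval : ∀ n a d → a + d ≤ n → count {n} (λ x → does (a ≤? toℕ x) ∧ does (toℕ x <? a + d)) ≡ d
count-interval n       zero    d a+d≤n       = count-below n d a+d≤n
count-interval (suc n) (suc a) d (s≤s a+d≤n) =
  trans (count-cong {n = n} λ x → cong (_∧ does (toℕ x <? a + d)) (suc≤?suc a (toℕ x))) (count-interval n a d a+d≤n)
  where
  suc≤?suc : ∀ a y → does (suc a ≤? suc y) ≡ does (a ≤? y)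
  suc≤?suc zero    _ = refl
  suc≤?suc (suc _) _ = refl

count-inBlock : (ns : Fin p → ℕ) (l : Fin p) → count (inBlock ns l) ≡ ns l
count-inBlock ns l = begin
  count (inBlock ns l)
    ≡⟨ count-cong {n = total ns} (λ x →
         cong (λ b → does (psum ns (toℕ l) ≤? toℕ x) ∧ does (toℕ x <? b)) (psum-suc ns l)) ⟩
  count {total ns} (λ x → does (psum ns (toℕ l) ≤? toℕ x) ∧ does (toℕ x <? psum ns (toℕ l) + ns l))
    ≡⟨ count-interval (total ns) (psum ns (toℕ l)) (ns l) block-end≤total ⟩
  ns l ∎
  where
  open ≡-Reasoning
  block-end≤total : psum ns (toℕ l) + ns l ≤ total ns
  block-end≤total = subst (_≤ total ns) (psum-suc ns l) (psum-mono ns (toℕ<n l))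

profile : (ns : Fin p → ℕ) → Subset (total ns) → Fin p → ℕ
profile ns F m = count (λ x → lookup F x ∧ inBlock ns m x)

∣∩block∣≡profile : (ns : Fin p → ℕ) (F : Subset (total ns)) (m : Fin p) → ∣ F ∩ block ns m ∣ ≡ profile ns F m
∣∩block∣≡profile ns F m =
  trans (∣p∩q∣≡count F (block ns m)) (count-cong λ x → cong (lookup F x ∧_) (lookup∘tabulate (inBlock ns m) x))

profile-mono : (ns : Fin p → ℕ) {F G : Subset (total ns)} → F ⊆ G → ∀ m → profile ns F m ≤ profile ns G m
profile-mono ns {F} {G} F⊆G m = count-mono λ x F[x]∧B →
  trans (cong (_∧ inBlock ns m x) (∈⇒lookup (F⊆G (lookup⇒∈ (∧-conicalˡ _ _ F[x]∧B)))))
        (∧-conicalʳ (lookup F x) _ F[x]∧B)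

module _ {p} {ns : Fin p → ℕ} {R : List (Fin p → ℕ)} where

  H₂-profile : (F G : Subset (total ns)) → (∀ m → profile ns G m ≡ profile ns F m) → H₂ ns R F → H₂ ns R G
  H₂-profile F G G≡F = Any.map λ F≡r m →
    trans (∣∩block∣≡profile ns G m) (trans (G≡F m) (trans (sym (∣∩block∣≡profile ns F m)) (F≡r m)))

  profile≤bmax : (F : Subset (total ns)) → H₂ ns R F → ∀ m → profile ns F m ≤ bmax R m
  profile≤bmax F F∈H₂ m = subst (_≤ bmax R m) (∣∩block∣≡profile ns F m) (go F∈H₂)
    where
    go : ∀ {R} → Any (λ r → ∀ m → ∣ F ∩ block ns m ∣ ≡ r m) R → ∣ F ∩ block ns m ∣ ≤ bmax R m
    go (here F≡r)  = ≤-trans (≤-reflexive (F≡r m)) (m≤m⊔n _ _)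
    go (there F∈R) = ≤-trans (go F∈R) (m≤n⊔m _ _)

  H₂-shift : {i j : Fin (total ns)} → (∀ m → inBlock ns m i ≡ inBlock ns m j)
    → ∀ F → H₂ ns R F → Shiftable i j F → H₂ ns R (shift i j F)
  H₂-shift {i} {j} same F F∈H₂ sh = H₂-profile F (shift i j F) (λ m → count-shift-∧ sh (inBlock ns m) (same m)) F∈H₂

  H₂? : (F : Subset (total ns)) → Dec (H₂ ns R F)
  H₂? F = Any.any? (λ r → all? λ m → ∣ F ∩ block ns m ∣ ℕ.≟ r m) R

-- The exchange argument

p⊆q∧x∈q∧x∉p⇒∣p∣<∣q∣ : ∀ {n} {p q : Subset n} {x : Fin n} → p ⊆ q → x ∈ q → x ∉ p → ∣ p ∣ < ∣ q ∣
p⊆q∧x∈q∧x∉p⇒∣p∣<∣q∣ {q = q} {x} p⊆q x∈q x∉p =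
  ≤-<-trans (p⊆q⇒∣p∣≤∣q∣ {q = q - x} λ y∈p → x∈p∧x≢y⇒x∈p-y (p⊆q y∈p) λ { refl → x∉p y∈p })
            (x∈p⇒∣p-x∣<∣p∣ x∈q)

k≤b∧c≤2b∧3b≤c+a⇒k≤a : ∀ {k b c a} → k ≤ b → c ≤ b + b → 3 * b ≤ c + a → k ≤ a
k≤b∧c≤2b∧3b≤c+a⇒k≤a {k} {b} {c} {a} k≤b c≤2b 3b≤c+a = ≤-trans k≤b (+-cancelˡ-≤ c b a (begin
  c + b         ≤⟨ +-monoˡ-≤ b c≤2b ⟩
  b + b + b     ≡⟨ +-assoc b b b ⟩
  b + (b + b)   ≡⟨ cong (λ z → b + (b + z)) (+-identityʳ b) ⟨
  3 * b         ≤⟨ 3b≤c+a ⟩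
  c + a         ∎))
  where open ≤-Reasoning

module _ {p t} {ns : Fin p → ℕ} {R : List (Fin p → ℕ)} {𝓕 : Family (total ns)}
  (𝓕⊑H₂ : 𝓕 ⊑ H₂ ns R) (𝓕-int : Intersecting t 𝓕) (3b≤n : ∀ m → 3 * bmax R m ≤ ns m)
  {i j : Fin (total ns)} {T : Subset (total ns)} (∣T∣≡t : ∣ T ∣ ≡ t) (Δ-star : StarOn (H₂ ns R) T (Δ i j 𝓕))
  where

  no-exchange : i ∈ T → ∀ {P Q} → 𝓕 P → T ⊆ P → j ∉ P → 𝓕 Q → i ∉ Q → ⊥
  no-exchange i∈T {P} {Q} 𝓕P T⊆P j∉P 𝓕Q i∉Q = C∉Δ (Δ-elim (star⁻ C∈H₂ T⊆C))
    where
    N : ℕ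
    N = total ns

    star⁻ : ∀ {F} → H₂ ns R F → T ⊆ F → Δ i j 𝓕 F
    star⁻ F∈H₂ T⊆F = Equivalence.from (Δ-star _) (F∈H₂ , T⊆F)

    free : Fin N → Bool
    free x = not (lookup P x ∨ lookup Q x)

    demand : Fin p → ℕ
    demand m = profile ns P m ∸ profile ns T m

    demand≤free : ∀ m → demand m ≤ count (λ x → free x ∧ inBlock ns m x)
    demand≤free m = k≤b∧c≤2b∧3b≤c+a⇒k≤a
      (≤-trans (m∸n≤m (profile ns P m) (profile ns T m)) (profile≤bmax P (𝓕⊑H₂ P 𝓕P) m))
      P∪Q≤2b
      (subst (3 * bmax R m ≤_) (sym (trans (count-∧-not {f = λ x → lookup P x ∨ lookup Q x}) (count-inBlock ns m)))
        (3b≤n m))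
      where
      P∪Q≤2b : count (λ x → (lookup P x ∨ lookup Q x) ∧ inBlock ns m x) ≤ bmax R m + bmax R m
      P∪Q≤2b = begin
        count (λ x → (lookup P x ∨ lookup Q x) ∧ inBlock ns m x)
          ≡⟨ count-cong {n = N} (λ x → ∧-distribʳ-∨ (inBlock ns m x) (lookup P x) (lookup Q x)) ⟩
        count (λ x → (lookup P x ∧ inBlock ns m x) ∨ (lookup Q x ∧ inBlock ns m x))
          ≤⟨ count-∨-≤ {f = λ x → lookup P x ∧ inBlock ns m x} {g = λ x → lookup Q x ∧ inBlock ns m x} ⟩
        profile ns P m + profile ns Q m
          ≤⟨ +-mono-≤ (profile≤bmax P (𝓕⊑H₂ P 𝓕P) m) (profile≤bmax Q (𝓕⊑H₂ Q 𝓕Q) m) ⟩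
        bmax R m + bmax R m ∎
        where open ≤-Reasoning

    chosen : Σ[ D ∈ (Fin N → Bool) ]
      (∀ x → D x ≡ true → free x ≡ true) × (∀ m → count (λ x → D x ∧ inBlock ns m x) ≡ demand m)
    chosen = choose-profile free (inBlock ns) (inBlock-disjoint ns) demand demand≤free

    D : Fin N → Bool
    D = proj₁ chosen

    D⇒free : ∀ x → D x ≡ true → free x ≡ true
    D⇒free = proj₁ (proj₂ chosen)

    count-D : ∀ m → count (λ x → D x ∧ inBlock ns m x) ≡ demand m
    count-D = proj₂ (proj₂ chosen)

    D⇒∉ : ∀ {x} → D x ≡ true → x ∉ P × x ∉ Q
    D⇒∉ {x} Dx = false⇒∉ (∨-conicalˡ _ _ P∨Q[x]) , false⇒∉ (∨-conicalʳ _ _ P∨Q[x])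
      where
      P∨Q[x] : lookup P x ∨ lookup Q x ≡ false
      P∨Q[x] = not-injective (D⇒free x Dx)

    -- C has the block sizes of P and meets P ∪ Q only inside T.
    C : Subset N
    C = tabulate (λ x → lookup T x ∨ D x)

    T⊆C : T ⊆ C
    T⊆C {x} x∈T = lookup⇒∈ (trans (lookup∘tabulate _ x) (cong (_∨ D x) (∈⇒lookup x∈T)))

    ∈C⇒∈T : ∀ {x} → x ∈ C → x ∈ P ⊎ x ∈ Q → x ∈ T
    ∈C⇒∈T {x} x∈C x∈P⊎Q with lookup T x in T[x]
    ... | true  = lookup⇒∈ T[x]
    ... | false with D⇒∉ (subst (λ b → b ∨ D x ≡ true) T[x] (trans (sym (lookup∘tabulate _ x)) (∈⇒lookup x∈C)))
    ...   | x∉P , x∉Q = ⊥-elim ([ x∉P , x∉Q ] x∈P⊎Q)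

    profile-C : ∀ m → profile ns C m ≡ profile ns P m
    profile-C m = begin
      profile ns C m
        ≡⟨ count-cong {n = N} (λ x → trans (cong (_∧ inBlock ns m x) (lookup∘tabulate _ x))
                                           (∧-distribʳ-∨ (inBlock ns m x) (lookup T x) (D x))) ⟩
      count (λ x → (lookup T x ∧ inBlock ns m x) ∨ (D x ∧ inBlock ns m x))
        ≡⟨ count-∨-disjoint (λ x → T∩D-empty (lookup T x) (D x) (inBlock ns m x) (T-D-disjoint x)) ⟩
      profile ns T m + count (λ x → D x ∧ inBlock ns m x)
        ≡⟨ cong (profile ns T m +_) (count-D m) ⟩
      profile ns T m + (profile ns P m ∸ profile ns T m)
        ≡⟨ m+[n∸m]≡n (profile-mono ns T⊆P m) ⟩
      profile ns P m ∎
      where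
      open ≡-Reasoning
      T-D-disjoint : ∀ x → lookup T x ≡ true → D x ≡ false
      T-D-disjoint x T[x] with D x in D[x]
      ... | true  = ⊥-elim (proj₁ (D⇒∉ D[x]) (T⊆P (lookup⇒∈ T[x])))
      ... | false = refl
      T∩D-empty : ∀ a d b → (a ≡ true → d ≡ false) → (a ∧ b) ∧ (d ∧ b) ≡ false
      T∩D-empty true  true  _     a⇒¬d = case a⇒¬d refl of λ ()
      T∩D-empty true  false true  _    = refl
      T∩D-empty true  false false _    = refl
      T∩D-empty false _     _     _    = refl

    C∈H₂ : H₂ ns R C
    C∈H₂ = H₂-profile P C profile-C (𝓕⊑H₂ P 𝓕P)

    no-small-intersection : ∀ {A B} → 𝓕 A → 𝓕 B → A ∩ B ⊆ T → i ∉ A ∩ B → ⊥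
    no-small-intersection {A} {B} 𝓕A 𝓕B A∩B⊆T i∉A∩B =
      <⇒≱ (p⊆q∧x∈q∧x∉p⇒∣p∣<∣q∣ A∩B⊆T i∈T i∉A∩B)
          (subst (_≤ ∣ A ∩ B ∣) (sym ∣T∣≡t) (𝓕-int A B 𝓕A 𝓕B))

    C∉Δ : 𝓕 C ⊎ Σ[ G ∈ Subset N ] 𝓕 G × Shiftable i j G × C ≡ shift i j G → ⊥
    C∉Δ (inj₁ 𝓕C) = no-small-intersection 𝓕C 𝓕Q C∩Q⊆T (i∉Q ∘ proj₂ ∘ x∈p∩q⁻ C Q)
      where
      C∩Q⊆T : C ∩ Q ⊆ T
      C∩Q⊆T x∈C∩Q with x∈p∩q⁻ C Q x∈C∩Q
      ... | x∈C , x∈Q = ∈C⇒∈T x∈C (inj₂ x∈Q)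
    C∉Δ (inj₂ (G , 𝓕G , (j∈G , i∉G) , C≡shiftG)) =
      no-small-intersection 𝓕G 𝓕P G∩P⊆T (i∉G ∘ proj₁ ∘ x∈p∩q⁻ G P)
      where
      G∩P⊆T : G ∩ P ⊆ T
      G∩P⊆T {x} x∈G∩P with x∈p∩q⁻ G P x∈G∩P
      ... | x∈G , x∈P = ∈C⇒∈T x∈C (inj₁ x∈P)
        where
        x∈C : x ∈ C
        x∈C = subst (x ∈_) (sym C≡shiftG) (∈-shift⁺ (λ { refl → i∉G x∈G }) (λ { refl → j∉P x∈P }) x∈G)

  shiftable-dichotomy : i ∈ T → (∀ F → 𝓕 F → ¬ Shiftable i j F) ⊎ (∀ F → 𝓕 F → T ⊆ F → j ∈ F)
  shiftable-dichotomy i∈T with anySubset? (λ A → H₂? A ×-dec (T ⊆? A ×-dec ¬? (j ∈? A)))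
  ... | no ∄A = inj₁ λ F 𝓕F sh →
    let shF∈H₂ , T⊆shF = shift-∈-star Δ-star 𝓕F sh
    in  ∄A (shift i j F , shF∈H₂ , T⊆shF , ∉-shiftʳ (shiftable⇒≢ sh) F)
  ... | yes (A , A∈H₂ , T⊆A , j∉A) with Δ-elim (Equivalence.from (Δ-star A) (A∈H₂ , T⊆A))
  ...   | inj₁ 𝓕A = inj₁ λ F 𝓕F (_ , i∉F) → no-exchange i∈T 𝓕A T⊆A j∉A 𝓕F i∉F
  ...   | inj₂ (G , 𝓕G , (_ , i∉G) , _) = inj₂ λ F 𝓕F T⊆F →
    decidable-stable (j ∈? F) λ j∉F → no-exchange i∈T 𝓕F T⊆F j∉F 𝓕G i∉G

2[1+t]b<n⇒3b≤n : ∀ {t b n} → 0 < t → 2 * suc t * b < n → 3 * b ≤ n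
2[1+t]b<n⇒3b≤n {t} {b} t>0 big = ≤-trans (*-monoˡ-≤ b (≤-trans (n≤1+n 3) (*-monoʳ-≤ 2 (s≤s t>0)))) (<⇒≤ big)

lemma2p4 : (p t : ℕ) → 0 < p → 0 < t
    → (ns : Fin p → ℕ) → (∀ i → 0 < ns i)
    → (R : List (Fin p → ℕ)) → R ≢ [] → All (λ r → ∀ i → 0 < r i) R
    → (𝓕 : Family (total ns)) → 𝓕 ⊑ H₂ ns R → Intersecting t 𝓕
    → (∀ m → 2 * (suc t) * bmax R m < ns m)
    → (l : Fin p) → (i j : Fin (total ns))
    → inBlock ns l i ≡ true → inBlock ns l j ≡ true
    → FullStar t (H₂ ns R) (Δ i j 𝓕)
    → FullStar t (H₂ ns R) 𝓕
lemma2p4 p t _ t>0 ns _ R _ _ 𝓕 𝓕⊑H₂ 𝓕-int big l i j i∈l j∈l (T , ∣T∣≡t , Δ-star)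
  with i ∈? T | j ∈? T
... | no i∉T  | _       = T , ∣T∣≡t , star-of-i∉T Δ-star 𝓕⊑H₂ i∉T
... | yes _   | yes j∈T = T , ∣T∣≡t , star-unshiftable Δ-star (unshiftable-of-j∈T Δ-star j∈T)
... | yes i∈T | no j∉T
  with shiftable-dichotomy 𝓕⊑H₂ 𝓕-int (λ m → 2[1+t]b<n⇒3b≤n t>0 (big m)) ∣T∣≡t Δ-star i∈T
...   | inj₁ unshiftable = T , ∣T∣≡t , star-unshiftable Δ-star unshiftable
...   | inj₂ j∈star =
  shift j i T , trans (∣shift∣ (i∈T , j∉T)) ∣T∣≡t ,
  star-of-shifted-centre Δ-star 𝓕⊑H₂ (H₂-shift (same-block (inBlock-disjoint ns) i∈l j∈l)) i∈T j∉T j∈star
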